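{- (1) For $\mathbf{L}\in\{\mathbf{K},\mathbf{K4}\}$, $\mathbf{L}^{Horn,\Box}$ and $\mathbf{L}^{Horn,\Diamond}$ are expressively incomparable. (2) For $\mathbf{L}\in\{\mathbf{K},\mathbf{K4}\}$, $\mathbf{L}^{Core,\Box}$ and $\mathbf{L}^{Core,\Diamond}$ are expressively incomparable. (3) For $\mathbf{L}\in\{\mathbf{K},\mathbf{T},\mathbf{K4},\mathbf{S4}\}$, $\mathbf{L}^{Krom,\Box}$ and $\mathbf{L}^{Krom,\Diamond}$ are expressively incomparable within the same propositional alphabet.
   Context: Fix a countable set $\mathcal P$ of propositional letters; Kripke models $M=(W,R,V)$ with $V:W\to2^{\mathcal P}$ and standard modal satisfaction. $\mathbf{K},\mathbf{T},\mathbf{K4},\mathbf{S4}$ are interpreted over all, reflexive, transitive, and reflexive-transitive frames respectively. A clause is $\Box^s(\neg\lambda_1\vee\dots\vee\neg\lambda_n\vee\lambda_{n+1}\vee\dots\vee\lambda_{n+m})$ ($s,n,m\ge0$) with positive literals $\lambda_i$; clausal-form formulas are finite conjunctions of clauses (literals count as clauses). Horn: all clauses have $m\le1$; Krom: $n+m\le2$; Core: both. In the box fragments ($\mathbf{L}^{Horn,\Box},\mathbf{L}^{Krom,\Box},\mathbf{L}^{Core,\Box}$) positive literals are generated by $\lambda::=\top\mid p\mid\Box\lambda$; in the diamond fragments ($\mathbf{L}^{Horn,\Diamond},\mathbf{L}^{Krom,\Diamond},\mathbf{L}^{Core,\Diamond}$) by $\lambda::=\top\mid p\mid\Diamond\lambda$.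 All are interpreted over the frame class of $\mathbf{L}$. For languages $\mathcal L_1,\mathcal L_2$ over the same frame class $\mathcal C$: a model-preserving translation from $\mathcal L_1$ to $\mathcal L_2$ is an effective map $\varphi\mapsto\varphi'$ over the same letters with $M,w\models\varphi$ iff $M,w\models\varphi'$ for all models $M$ over frames in $\mathcal C$ and worlds $w$; a model-extending translation sends each $\mathcal L_1$-formula $\varphi$ over alphabet $\mathcal P_0$ to an $\mathcal L_2$-formula $\varphi'$ over a finite extension $\mathcal P'\supseteq\mathcal P_0$ such that $M,w\models\varphi$ iff the valuation of $M$ can be extended to $\mathcal P'$ giving $M'$ with $M',w\models\varphi'$. Two languages are expressively incomparable if there is no model-extending translation from either into the other; they are expressively incomparable within the same propositional alphabet if there is no model-preserving translation from either into the other. -}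

module Defs where

open import Data.Nat using (ℕ; zero; suc; _+_; _≤_)
open import Data.Bool using (Bool; true)
open import Data.List using (List; []; _∷_; _++_; length; concatMap)
open import Data.List.Relation.Unary.All using (All)
open import Data.List.Relation.Unary.Any using (Any)
open import Data.List.Membership.Propositional using (_∈_)
open import Data.Product using (Σ; _×_; _,_)
open import Data.Sum using (_⊎_)
open import Data.Unit using (⊤)
open import Relation.Nullary using (¬_)
open import Relation.Binary.PropositionalEquality using (_≡_)

record Model : Set₁ where
  field
    W : Set
    R : W → W → Set
    V : W → ℕ → Bool
open Model public

data Logic : Set where
  K T K4 S4 : Logic

Reflexive : Model → Set
Reflexive M = ∀ w → R M w w

Transitive : Model → Set
Transitive M = ∀ {u v w} → R M u v → R M v w → R M u w

FrameOf : Logic → Model → Set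
FrameOf K  M = ⊤
FrameOf T  M = Reflexive M
FrameOf K4 M = Transitive M
FrameOf S4 M = Reflexive M × Transitive M

-- Which modal operator may occur inside positive literals.
data Mod : Set where
  box dia : Mod

-- Positive literals  λ ::= ⊤ | p | □λ   (box)   or   ⊤ | p | ◇λ   (dia)
data PosLit (m : Mod) : Set where
  top : PosLit m
  var : ℕ → PosLit m
  op  : PosLit m → PosLit m

-- □^s (¬λ₁ ∨ … ∨ ¬λₙ ∨ λₙ₊₁ ∨ … ∨ λₙ₊ₘ)
record Clause (m : Mod) : Set where
  constructor clause
  field
    depth : ℕ
    negs  : List (PosLit m)
    poss  : List (PosLit m)
open Clause public

Formula : Mod → Set
Formula m = List (Clause m)

data Frag : Set where
  Horn Krom Core : Frag

ClauseIn : ∀ {m} → Frag → Clause m → Set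
ClauseIn Horn c = length (poss c) ≤ 1
ClauseIn Krom c = length (negs c) + length (poss c) ≤ 2
ClauseIn Core c = length (poss c) ≤ 1 × length (negs c) + length (poss c) ≤ 2

InFrag : ∀ {m} → Frag → Formula m → Set
InFrag F φ = All (ClauseIn F) φ

varsLit : ∀ {m} → PosLit m → List ℕ
varsLit top     = []
varsLit (var p) = p ∷ []
varsLit (op l)  = varsLit l

varsClause : ∀ {m} → Clause m → List ℕ
varsClause c = concatMap varsLit (negs c) ++ concatMap varsLit (poss c)

vars : ∀ {m} → Formula m → List ℕ
vars φ = concatMap varsClause φ

satLit : ∀ {m} (M : Model) → W M → PosLit m → Set
satLit M w top = ⊤
satLit M w (var p) = V M w p ≡ true
satLit {box} M w (op l) = ∀ v → R M w v → satLit M v l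
satLit {dia} M w (op l) = Σ (W M) λ v → R M w v × satLit M v l

boxes : (M : Model) → ℕ → (W M → Set) → W M → Set
boxes M zero    P w = P w
boxes M (suc s) P w = ∀ v → R M w v → boxes M s P v

satClause : ∀ {m} (M : Model) → W M → Clause m → Set
satClause M w c =
  boxes M (depth c)
    (λ v → Any (λ l → ¬ satLit M v l) (negs c) ⊎ Any (satLit M v) (poss c)) w

sat : ∀ {m} (M : Model) → W M → Formula m → Set
sat M w φ = All (satClause M w) φ

reval : (M : Model) → (W M → ℕ → Bool) → Model
reval M V' = record { W = W M ; R = R M ; V = V' }

_⇔_ : Set → Set → Set
A ⇔ B = (A → B) × (B → A)

ModelPreserving : Logic → Frag → Mod → Frag → Mod → Set₁
ModelPreserving L F₁ m₁ F₂ m₂ =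
  Σ ((φ : Formula m₁) → InFrag F₁ φ → Formula m₂) λ tr →
    ∀ φ (h : InFrag F₁ φ) →
      InFrag F₂ (tr φ h)
      × (∀ p → p ∈ vars (tr φ h) → p ∈ vars φ)
      × (∀ (M : Model) → FrameOf L M → ∀ w → sat M w φ ⇔ sat M w (tr φ h))

-- model-extending: φ (over the alphabet of its letters) holds at w iff the
-- valuation can be extended (i.e. changed only outside the letters of φ)
-- so that the translation holds at w.
ModelExtending : Logic → Frag → Mod → Frag → Mod → Set₁
ModelExtending L F₁ m₁ F₂ m₂ =
  Σ ((φ : Formula m₁) → InFrag F₁ φ → Formula m₂) λ tr →
    ∀ φ (h : InFrag F₁ φ) →
      InFrag F₂ (tr φ h)
      × (∀ (M : Model) → FrameOf L M → ∀ w →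
           sat M w φ ⇔
           Σ (W M → ℕ → Bool) λ V' →
             (∀ u p → p ∈ vars φ → V' u p ≡ V M u p)
             × sat (reval M V') w (tr φ h))

Incomparable : Logic → Frag → Set₁
Incomparable L F =
  ¬ ModelExtending L F box F dia × ¬ ModelExtending L F dia F box

IncomparableSameAlphabet : Logic → Frag → Set₁
IncomparableSameAlphabet L F =
  ¬ ModelPreserving L F box F dia × ¬ ModelPreserving L F dia F box

-- Horn formulas are preserved by products of pointed models in which a positive literal holds
-- exactly when it holds in both factors: box-Horn formulas by intersecting two valuations on a
-- common frame, diamond-Horn formulas by multiplying a pointed model with a dead end (the product
-- is again a dead end). A model-extending translation into a Horn fragment passes such a closure
-- property on to the source formula, since the added letters can be intersected as well. But
-- □p → q holds at the root of a chain whose leaf refutes p and at a dead end satisfying q, and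
-- fails at their product, a dead end refuting q; and ◇p holds at the root of a fork under the two
-- valuations making p true at one leaf each, but not under their intersection. Among formulas
-- over the same letters, ¬□p and ◇p separate two pointed models on the two-point universal frame
-- that no diamond, resp. box, formula separates, because every positive literal of that kind has
-- the same truth value at the two points.
module Submission where

open import Defs
open import Data.Bool using (Bool; true; false; _∧_)
open import Data.Bool.Properties using (∧-conicalˡ; ∧-conicalʳ)
open import Data.Empty using (⊥)
open import Data.List using (List; []; _∷_; length)
open import Data.List.Membership.Propositional using (_∈_)
open import Data.List.Relation.Unary.All using ([]; _∷_)
import Data.List.Relation.Unary.All as All
open import Data.List.Relation.Unary.Any using (Any; here)
import Data.List.Relation.Unary.Any as Any
open import Data.Nat using (ℕ; zero; suc; _≤_; z≤n; s≤s)
open import Data.Product using (Σ; _×_; _,_; proj₁; proj₂)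
open import Data.Sum using (_⊎_; inj₁; inj₂)
open import Data.Unit using (⊤; tt)
open import Relation.Binary.PropositionalEquality using (_≡_; _≢_; refl; sym; trans; cong₂)
open import Relation.Nullary using (¬_)

∧≡true⇔ : ∀ a b → ((a ∧ b) ≡ true) ⇔ (a ≡ true × b ≡ true)
∧≡true⇔ a b = (λ e → ∧-conicalˡ a b e , ∧-conicalʳ a b e) , λ { (refl , refl) → refl }

false≢true : false ≢ true
false≢true ()

_∧ᵛ_ : {A : Set} → (A → ℕ → Bool) → (A → ℕ → Bool) → A → ℕ → Bool
(V₁ ∧ᵛ V₂) u p = V₁ u p ∧ V₂ u p

frameOf-reval : ∀ L {M} V → FrameOf L M → FrameOf L (reval M V)
frameOf-reval K  V f = f
frameOf-reval T  V f = f
frameOf-reval K4 V f = f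
frameOf-reval S4 V f = f

HornFragment : Frag → Set
HornFragment F = ∀ {m} {c : Clause m} → ClauseIn F c → ClauseIn Horn c

ContainsTransitive : Logic → Set₁
ContainsTransitive L = ∀ M → Transitive M → FrameOf L M

Body : {A : Set} → (A → Set) → List A → List A → Set
Body S ns ps = Any (λ l → ¬ S l) ns ⊎ Any S ps

any-×-singleton : ∀ {A : Set} {P Q : A → Set} (xs : List A) → length xs ≤ 1 →
  Any P xs → Any Q xs → Any (λ x → P x × Q x) xs
any-×-singleton (x ∷ [])     _         (here p)   (here q)   = here (p , q)
any-×-singleton (x ∷ y ∷ xs) (s≤s ())  _          _

body-× : ∀ {A : Set} {P Q S : A → Set} ns ps → length ps ≤ 1 →
  (∀ {l} → S l ⇔ (P l × Q l)) → Body P ns ps → Body Q ns ps → Body S ns ps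
body-× ns ps h S⇔ (inj₁ ¬P) _ = inj₁ (Any.map (λ ¬p s → ¬p (proj₁ (proj₁ S⇔ s))) ¬P)
body-× ns ps h S⇔ (inj₂ _) (inj₁ ¬Q) = inj₁ (Any.map (λ ¬q s → ¬q (proj₂ (proj₁ S⇔ s))) ¬Q)
body-× ns ps h S⇔ (inj₂ P) (inj₂ Q) =
  inj₂ (Any.map (proj₂ S⇔) (any-×-singleton ps h P Q))

record Product (m : Mod) (M₁ M₂ M₃ : Model) : Set where
  field
    π₁ : W M₃ → W M₁
    π₂ : W M₃ → W M₂
    π₁-hom : ∀ {u v} → R M₃ u v → R M₁ (π₁ u) (π₁ v)
    π₂-hom : ∀ {u v} → R M₃ u v → R M₂ (π₂ u) (π₂ v)
    satLit-π : ∀ u (l : PosLit m) →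
      satLit M₃ u l ⇔ (satLit M₁ (π₁ u) l × satLit M₂ (π₂ u) l)

module _ {m M₁ M₂ M₃} (P : Product m M₁ M₂ M₃) where
  open Product P

  boxes-product : ∀ s {P₁ P₂ P₃} → (∀ u → P₁ (π₁ u) → P₂ (π₂ u) → P₃ u) → ∀ u →
    boxes M₁ s P₁ (π₁ u) → boxes M₂ s P₂ (π₂ u) → boxes M₃ s P₃ u
  boxes-product zero    k u b₁ b₂ = k u b₁ b₂
  boxes-product (suc s) k u b₁ b₂ v r =
    boxes-product s k v (b₁ _ (π₁-hom r)) (b₂ _ (π₂-hom r))

  sat-product : ∀ (ψ : Formula m) → InFrag Horn ψ → ∀ w →
    sat M₁ (π₁ w) ψ → sat M₂ (π₂ w) ψ → sat M₃ w ψ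
  sat-product []      []       w []         []         = []
  sat-product (c ∷ ψ) (h ∷ hs) w (s₁ ∷ ss₁) (s₂ ∷ ss₂) =
    boxes-product (depth c) (λ u → body-× (negs c) (poss c) h (satLit-π u _)) w s₁ s₂
    ∷ sat-product ψ hs w ss₁ ss₂

∧ᵛ-product : ∀ M V₁ V₂ → Product box (reval M V₁) (reval M V₂) (reval M (V₁ ∧ᵛ V₂))
∧ᵛ-product M V₁ V₂ = record
  { π₁ = λ u → u ; π₂ = λ u → u ; π₁-hom = λ r → r ; π₂-hom = λ r → r ; satLit-π = lit }
  where
  lit : ∀ u l → satLit (reval M (V₁ ∧ᵛ V₂)) u l
              ⇔ (satLit (reval M V₁) u l × satLit (reval M V₂) u l)
  lit u top     = (λ _ → tt , tt) , λ _ → tt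
  lit u (var p) = ∧≡true⇔ (V₁ u p) (V₂ u p)
  lit u (op l)  = (λ f → (λ v r → proj₁ (proj₁ (lit v l) (f v r)))
                       , (λ v r → proj₂ (proj₁ (lit v l) (f v r))))
                , λ { (f₁ , f₂) v r → proj₂ (lit v l) (f₁ v r , f₂ v r) }

DeadEnd : (⊤ → ℕ → Bool) → Model
DeadEnd U = record { W = ⊤ ; R = λ _ _ → ⊥ ; V = U }

deadEnd-transitive : ∀ U → Transitive (DeadEnd U)
deadEnd-transitive U ()

deadEnd-product : ∀ M x U → Product dia M (DeadEnd U) (DeadEnd ((λ _ → V M x) ∧ᵛ U))
deadEnd-product M x U = record
  { π₁ = λ _ → x ; π₂ = λ u → u ; π₁-hom = λ () ; π₂-hom = λ () ; satLit-π = lit }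
  where
  lit : ∀ u l → satLit (DeadEnd ((λ _ → V M x) ∧ᵛ U)) u l
              ⇔ (satLit M x l × satLit (DeadEnd U) u l)
  lit u top     = (λ _ → tt , tt) , λ _ → tt
  lit u (var p) = ∧≡true⇔ (V M x p) (U u p)
  lit u (op l)  = (λ { (_ , () , _) }) , λ { (_ , _ , () , _) }

extending-box-Horn⇒∧ᵛ-closed : ∀ {L F₁ m F₂} →
  HornFragment F₂ → ModelExtending L F₁ m F₂ box →
  ∀ φ → InFrag F₁ φ → ∀ M → FrameOf L M → ∀ V₁ V₂ w →
  sat (reval M V₁) w φ → sat (reval M V₂) w φ → sat (reval M (V₁ ∧ᵛ V₂)) w φ
extending-box-Horn⇒∧ᵛ-closed {L} horn (tr , prop) φ h M f V₁ V₂ w s₁ s₂ =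
  let (V₁′ , agree₁ , t₁) = proj₁ (expresses V₁) s₁
      (V₂′ , agree₂ , t₂) = proj₁ (expresses V₂) s₂
  in proj₂ (expresses (V₁ ∧ᵛ V₂))
       ( V₁′ ∧ᵛ V₂′
       , (λ u p p∈ → cong₂ _∧_ (agree₁ u p p∈) (agree₂ u p p∈))
       , sat-product (∧ᵛ-product M V₁′ V₂′) (tr φ h)
           (All.map horn (proj₁ (prop φ h))) w t₁ t₂ )
  where
  expresses : ∀ V → sat (reval M V) w φ ⇔
    Σ (W M → ℕ → Bool) λ V′ →
      (∀ u p → p ∈ vars φ → V′ u p ≡ V u p) × sat (reval M V′) w (tr φ h)
  expresses V = proj₂ (prop φ h) (reval M V) (frameOf-reval L V f) w

extending-dia-Horn⇒deadEnd-closed : ∀ {L F₁ m F₂} →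
  HornFragment F₂ → ModelExtending L F₁ m F₂ dia →
  ContainsTransitive L → ∀ φ → InFrag F₁ φ → ∀ M → FrameOf L M → ∀ x U →
  sat M x φ → sat (DeadEnd U) tt φ → sat (DeadEnd ((λ _ → V M x) ∧ᵛ U)) tt φ
extending-dia-Horn⇒deadEnd-closed {L} horn (tr , prop) transitive⇒L φ h M f x U s₁ s₂ =
  let (V′ , agree₁ , t₁) = proj₁ (expresses M f x) s₁
      (U′ , agree₂ , t₂) = proj₁ (expresses (DeadEnd U) (deadEnd U) tt) s₂
  in proj₂ (expresses (DeadEnd ((λ _ → V M x) ∧ᵛ U)) (deadEnd _) tt)
       ( (λ _ → V′ x) ∧ᵛ U′
       , (λ u p p∈ → cong₂ _∧_ (agree₁ x p p∈) (agree₂ u p p∈))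
       , sat-product (deadEnd-product (reval M V′) x U′) (tr φ h)
           (All.map horn (proj₁ (prop φ h))) tt t₁ t₂ )
  where
  deadEnd : ∀ U → FrameOf L (DeadEnd U)
  deadEnd U = transitive⇒L (DeadEnd U) (deadEnd-transitive U)
  expresses : ∀ M → FrameOf L M → ∀ w → sat M w φ ⇔
    Σ (W M → ℕ → Bool) λ V′ →
      (∀ u p → p ∈ vars φ → V′ u p ≡ V M u p) × sat (reval M V′) w (tr φ h)
  expresses M f w = proj₂ (prop φ h) M f w

□p⇒q : Formula box
□p⇒q = clause 0 (op (var 0) ∷ []) (var 1 ∷ []) ∷ []

◇p : Formula dia
◇p = clause 0 [] (op (var 0) ∷ []) ∷ []

data Edge : Bool → Bool → Set where
  edge : Edge false true

twoChain : Model
twoChain = record { W = Bool ; R = Edge ; V = λ _ _ → false }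

twoChain-transitive : Transitive twoChain
twoChain-transitive edge ()

¬extending-box→dia : ∀ {L F} → HornFragment F → InFrag F □p⇒q → ContainsTransitive L →
  ¬ ModelExtending L F box F dia
¬extending-box→dia horn h transitive⇒L tr =
  fails (extending-dia-Horn⇒deadEnd-closed horn tr transitive⇒L □p⇒q h
           twoChain (transitive⇒L twoChain twoChain-transitive) false (λ _ _ → true)
           (inj₁ (here (λ □p → false≢true (□p true edge))) ∷ [])
           (inj₂ (here refl) ∷ []))
  where
  fails : ¬ sat (DeadEnd (λ _ _ → false)) tt □p⇒q
  fails (inj₁ (here ¬□p) ∷ []) = ¬□p (λ _ ())
  fails (inj₂ (here ())  ∷ [])

data Fork : Set where
  root left right : Fork

data ForkEdge : Fork → Fork → Set where
  toLeft  : ForkEdge root left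
  toRight : ForkEdge root right

fork : Model
fork = record { W = Fork ; R = ForkEdge ; V = λ _ _ → false }

fork-transitive : Transitive fork
fork-transitive toLeft  ()
fork-transitive toRight ()

trueAtLeft trueAtRight : Fork → ℕ → Bool
trueAtLeft left _ = true
trueAtLeft _    _ = false
trueAtRight right _ = true
trueAtRight _     _ = false

¬extending-dia→box : ∀ {L F} → HornFragment F → InFrag F ◇p → ContainsTransitive L →
  ¬ ModelExtending L F dia F box
¬extending-dia→box horn h transitive⇒L tr =
  fails (extending-box-Horn⇒∧ᵛ-closed horn tr ◇p h
           fork (transitive⇒L fork fork-transitive) trueAtLeft trueAtRight root
           (inj₂ (here (left , toLeft , refl)) ∷ [])
           (inj₂ (here (right , toRight , refl)) ∷ []))
  where
  fails : ¬ sat (reval fork (trueAtLeft ∧ᵛ trueAtRight)) root ◇p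
  fails (inj₂ (here (left  , toLeft  , ())) ∷ [])
  fails (inj₂ (here (right , toRight , ())) ∷ [])

separated⇒¬preserving : ∀ {L F₁ m₁ F₂ m₂} φ → InFrag F₁ φ →
  ∀ M M′ → FrameOf L M → FrameOf L M′ → ∀ w w′ →
  sat M w φ → ¬ sat M′ w′ φ → (∀ (ψ : Formula m₂) → sat M w ψ → sat M′ w′ ψ) →
  ¬ ModelPreserving L F₁ m₁ F₂ m₂
separated⇒¬preserving φ h M M′ f f′ w w′ s ¬s′ transfer (tr , prop) =
  ¬s′ (proj₂ (equiv M′ f′ w′) (transfer (tr φ h) (proj₁ (equiv M f w) s)))
  where
  equiv = proj₂ (proj₂ (prop φ h))

boxes-loop : ∀ M s {P} {w} → R M w w → boxes M s P w → P w
boxes-loop M zero    r b = b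
boxes-loop M (suc s) r b = boxes-loop M s r (b _ r)

boxes-everywhere : ∀ M s {P} → (∀ v → P v) → ∀ w → boxes M s P w
boxes-everywhere M zero    k w = k w
boxes-everywhere M (suc s) k w v _ = boxes-everywhere M s k v

-- A reflexive point w satisfies a clause only if it satisfies its body, which then transfers
-- to every point of M′.
sat-transfer : ∀ {m} M M′ {w} → R M w w →
  (∀ v (l : PosLit m) → satLit M w l ⇔ satLit M′ v l) →
  ∀ w′ (ψ : Formula m) → sat M w ψ → sat M′ w′ ψ
sat-transfer M M′ r lit w′ []      []       = []
sat-transfer M M′ r lit w′ (c ∷ ψ) (s ∷ ss) =
  boxes-everywhere M′ (depth c) (body (boxes-loop M (depth c) r s)) w′
  ∷ sat-transfer M M′ r lit w′ ψ ss
  where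
  body : Body (satLit M _) (negs c) (poss c) → ∀ v → Body (satLit M′ v) (negs c) (poss c)
  body (inj₁ ¬s) v = inj₁ (Any.map (λ ¬sl sl′ → ¬sl (proj₂ (lit v _) sl′)) ¬s)
  body (inj₂ s)  v = inj₂ (Any.map (proj₁ (lit v _)) s)

universal : (Bool → ℕ → Bool) → Model
universal V = record { W = Bool ; R = λ _ _ → ⊤ ; V = V }

universal-frameOf : ∀ L V → FrameOf L (universal V)
universal-frameOf K  V = tt
universal-frameOf T  V = λ _ → tt
universal-frameOf K4 V = λ _ _ → tt
universal-frameOf S4 V = (λ _ → tt) , (λ _ _ → tt)

trueAtTrue everywhere nowhere : Bool → ℕ → Bool
trueAtTrue u _ = u
everywhere _ _ = true
nowhere    _ _ = false

dia-satLit-at-true-loop : ∀ M {w} → R M w w → (∀ p → V M w p ≡ true) →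
  (l : PosLit dia) → satLit M w l
dia-satLit-at-true-loop M r t top     = tt
dia-satLit-at-true-loop M r t (var p) = t p
dia-satLit-at-true-loop M r t (op l)  = _ , r , dia-satLit-at-true-loop M r t l

¬□p : Formula box
¬□p = clause 0 (op (var 0) ∷ []) [] ∷ []

¬preserving-box→dia-Krom : ∀ L → ¬ ModelPreserving L Krom box Krom dia
¬preserving-box→dia-Krom L =
  separated⇒¬preserving {F₁ = Krom} {F₂ = Krom} ¬□p (s≤s z≤n ∷ [])
    (universal trueAtTrue) (universal everywhere) (universal-frameOf L _) (universal-frameOf L _)
    true true (inj₁ (here (λ □p → false≢true (□p false tt))) ∷ []) fails
    (sat-transfer (universal trueAtTrue) (universal everywhere) tt lit true)
  where
  fails : ¬ sat (universal everywhere) true ¬□p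
  fails (inj₁ (here ¬□p) ∷ []) = ¬□p (λ _ _ → refl)
  lit : ∀ v l → satLit (universal trueAtTrue) true l ⇔ satLit (universal everywhere) v l
  lit v l = (λ _ → dia-satLit-at-true-loop (universal everywhere) tt (λ _ → refl) l)
          , (λ _ → dia-satLit-at-true-loop (universal trueAtTrue) tt (λ _ → refl) l)

LetterFree : ∀ {m} → PosLit m → Set
LetterFree top     = ⊤
LetterFree (var p) = ⊥
LetterFree (op l)  = LetterFree l

letterFree⇒satLit : ∀ M w (l : PosLit box) → LetterFree l → satLit M w l
letterFree⇒satLit M w top    _  = tt
letterFree⇒satLit M w (op l) lf = λ v _ → letterFree⇒satLit M v l lf

box-satLit-at-false-loop⇒letterFree : ∀ M {w} → R M w w → (∀ p → V M w p ≡ false) →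
  (l : PosLit box) → satLit M w l → LetterFree l
box-satLit-at-false-loop⇒letterFree M r f top     _ = tt
box-satLit-at-false-loop⇒letterFree M r f (var p) s = false≢true (trans (sym (f p)) s)
box-satLit-at-false-loop⇒letterFree M r f (op l)  s =
  box-satLit-at-false-loop⇒letterFree M r f l (s _ r)

¬preserving-dia→box-Krom : ∀ L → ¬ ModelPreserving L Krom dia Krom box
¬preserving-dia→box-Krom L =
  separated⇒¬preserving {F₁ = Krom} {F₂ = Krom} ◇p (s≤s z≤n ∷ [])
    (universal trueAtTrue) (universal nowhere) (universal-frameOf L _) (universal-frameOf L _)
    false false (inj₂ (here (true , tt , refl)) ∷ []) fails
    (sat-transfer (universal trueAtTrue) (universal nowhere) tt lit false)
  where
  fails : ¬ sat (universal nowhere) false ◇p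
  fails (inj₂ (here (_ , _ , ())) ∷ [])
  lit : ∀ v l → satLit (universal trueAtTrue) false l ⇔ satLit (universal nowhere) v l
  lit v l = (λ s → letterFree⇒satLit (universal nowhere) v l
                     (box-satLit-at-false-loop⇒letterFree (universal trueAtTrue) tt (λ _ → refl) l s))
          , (λ s → letterFree⇒satLit (universal trueAtTrue) false l
                     (box-satLit-at-false-loop⇒letterFree (universal nowhere) tt (λ _ → refl) l s))

containsTransitive : ∀ L → L ≡ K ⊎ L ≡ K4 → ContainsTransitive L
containsTransitive .K  (inj₁ refl) M t = tt
containsTransitive .K4 (inj₂ refl) M t = t

horn-incomparable : ∀ {L} F → HornFragment F → InFrag F □p⇒q → InFrag F ◇p →
  ContainsTransitive L → Incomparable L F
horn-incomparable F horn h₁ h₂ transitive⇒L =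
  ¬extending-box→dia horn h₁ transitive⇒L , ¬extending-dia→box horn h₂ transitive⇒L

corollary3p12 :
    (∀ L → L ≡ K ⊎ L ≡ K4 → Incomparable L Horn)
    × (∀ L → L ≡ K ⊎ L ≡ K4 → Incomparable L Core)
    × (∀ L → IncomparableSameAlphabet L Krom)
corollary3p12 =
    (λ L e → horn-incomparable Horn (λ h → h) (s≤s z≤n ∷ []) (s≤s z≤n ∷ [])
               (containsTransitive L e))
  , (λ L e → horn-incomparable Core proj₁
               ((s≤s z≤n , s≤s (s≤s z≤n)) ∷ []) ((s≤s z≤n , s≤s z≤n) ∷ [])
               (containsTransitive L e))
  , (λ L → ¬preserving-box→dia-Krom L , ¬preserving-dia→box-Krom L)
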